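{- Each action of MMA$^-$ replaces an equation set by an i-equivalent one; i.e. if an action (1), (3), (4), (5) or (5') of MMA$^-$ transforms an equation set $E$ into $E'$, then $E$ and $E'$ have the same set of i-solutions.
   Context: MMA$^-$ acts on finite sets of equations between terms by nondeterministically selecting an equation and performing: (1) $f(s_1,\dots,s_n)=f(t_1,\dots,t_n)$: replace it by $s_1=t_1,\dots,s_n=t_n$; (2) $f(\dots)=g(\dots)$ with $f\neq g$: halt with failure; (3) $X=X$: delete it; (4) $t=X$ with $t$ not a variable: replace by $X=t$; (5) $X=t$ with $X\neq t$ and $X$ occurring in another equation: apply $\{X/t\}$ to all other equations; (5') $X=t$ with $X\neq t$ and $X$ occurring elsewhere: replace some occurrences of $X$ in the other equations by $t$ (allowed only if (5) was previously performed on some $X=t'$). I-terms are possibly infinite terms over the given alphabet of function symbols (including constants); an i-substitution maps variables to i-terms. An i-substitution $\theta$ is an i-solution of an equation $t=u$ if $t\theta$ and $u\theta$ are identical, and of a set of equations if it is an i-solution of each equation in it. Two equation sets are i-equivalent if they have the same set of i-solutions. -}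

module Defs where

open import Data.Nat using (ℕ; _<_; _<?_)
open import Data.Maybe using (Maybe; just; nothing; Is-just)
open import Data.Nat.Properties using (_≟_)
open import Data.Fin using (Fin; fromℕ<)
open import Data.Bool using (Bool; true)
open import Data.List using (List; []; _∷_; _++_; _∷ʳ_; map; tabulate)
open import Data.List.Relation.Unary.All using (All)
open import Data.List.Relation.Unary.Any using (Any)
open import Data.List.Relation.Binary.Pointwise using (Pointwise)
open import Data.Product using (_×_; _,_; Σ; ∃; proj₁)
open import Data.Sum using (_⊎_)
open import Function using (_∘_)
open import Function.Bundles using (_⇔_)
open import Relation.Nullary using (¬_; yes; no)
open import Relation.Binary.PropositionalEquality using (_≡_; subst)

record Signature : Set₁ where
  field
    F  : Set
    ar : F → ℕ

Var : Set
Var = ℕ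

module _ (S : Signature) where
  open Signature S

  data Term : Set where
    var : Var → Term
    fun : (f : F) → (Fin (ar f) → Term) → Term


module _ {S : Signature} where
  open Signature S

  -- Possibly infinite terms (i-terms), in the standard representation as
  -- labelled trees: a tree assigns to each position (a path of argument
  -- indices, read from the root) the function symbol there, or nothing
  -- if the position is not in the tree.
  Pos : Set
  Pos = List ℕ

  Tree : Set
  Tree = Pos → Maybe F

  record IsITerm (t : Tree) : Set where
    field
      root   : Is-just (t [])
      prefix : ∀ p i → Is-just (t (p ∷ʳ i)) → Is-just (t p)
      arity  : ∀ p f i → t p ≡ just f → (i < ar f ⇔ Is-just (t (p ∷ʳ i)))

  ITerm : Set
  ITerm = Σ Tree IsITerm

  _≈ᵢ_ : Tree → Tree → Set
  s ≈ᵢ t = ∀ (p : Pos) → s p ≡ t p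

  ISubst : Set
  ISubst = Var → ITerm

  _⟪_⟫ : Term S → ISubst → Tree
  (var x    ⟪ θ ⟫) p = proj₁ (θ x) p
  (fun f ts ⟪ θ ⟫) [] = just f
  (fun f ts ⟪ θ ⟫) (i ∷ p) with i <? ar f
  ... | yes lt = (ts (fromℕ< lt) ⟪ θ ⟫) p
  ... | no  _  = nothing

  Eqn : Set
  Eqn = Term S × Term S

  Eqns : Set
  Eqns = List Eqn

  ISolEq : ISubst → Eqn → Set
  ISolEq θ (s , t) = (s ⟪ θ ⟫) ≈ᵢ (t ⟪ θ ⟫)

  ISol : ISubst → Eqns → Set
  ISol θ E = All (ISolEq θ) E

  IEquiv : Eqns → Eqns → Set
  IEquiv E E' = ∀ (θ : ISubst) → ISol θ E ⇔ ISol θ E'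

  data Occurs (X : Var) : Term S → Set where
    here  : Occurs X (var X)
    there : ∀ {f ts} (i : Fin (ar f)) → Occurs X (ts i) → Occurs X (fun f ts)

  OccursEq : Var → Eqn → Set
  OccursEq X (s , t) = Occurs X s ⊎ Occurs X t

  [_↦_] : Var → Term S → Term S → Term S
  [ X ↦ t ] (var y) with y ≟ X
  ... | yes _ = t
  ... | no  _ = var y
  [ X ↦ t ] (fun f us) = fun f (λ i → [ X ↦ t ] (us i))

  [_↦_]ₑ : Var → Term S → Eqn → Eqn
  [ X ↦ t ]ₑ (u , v) = [ X ↦ t ] u , [ X ↦ t ] v

  -- Replacing some (possibly none) of the occurrences of X by t.
  data Repl (X : Var) (t : Term S) : Term S → Term S → Set where
    keepX : Repl X t (var X) (var X)
    replX : Repl X t (var X) t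
    keepV : ∀ {y} → Repl X t (var y) (var y)
    under : ∀ {f us us'} → (∀ i → Repl X t (us i) (us' i)) →
            Repl X t (fun f us) (fun f us')

  ReplEq : Var → Term S → Eqn → Eqn → Set
  ReplEq X t (u , v) (u' , v') = Repl X t u u' × Repl X t v v'

  -- The Boolean flag
  -- records whether action (5) has previously been performed (on some
  -- X = t'), which is the precondition of action (5').
  data Action (done5 : Bool) : Eqns → Eqns → Set where
    act1  : ∀ E₁ E₂ f (ss ts : Fin (ar f) → Term S) →
            Action done5 (E₁ ++ (fun f ss , fun f ts) ∷ E₂)
                         (E₁ ++ tabulate (λ i → ss i , ts i) ++ E₂)
    act3  : ∀ E₁ E₂ X →
            Action done5 (E₁ ++ (var X , var X) ∷ E₂) (E₁ ++ E₂)
    act4  : ∀ E₁ E₂ X f (ts : Fin (ar f) → Term S) →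
            Action done5 (E₁ ++ (fun f ts , var X) ∷ E₂)
                         (E₁ ++ (var X , fun f ts) ∷ E₂)
    act5  : ∀ E₁ E₂ X t → ¬ (t ≡ var X) →
            Any (OccursEq X) (E₁ ++ E₂) →
            Action done5 (E₁ ++ (var X , t) ∷ E₂)
                         (map [ X ↦ t ]ₑ E₁ ++ (var X , t) ∷ map [ X ↦ t ]ₑ E₂)
    act5' : ∀ E₁ E₂ E₁' E₂' X t → done5 ≡ true → ¬ (t ≡ var X) →
            Any (OccursEq X) (E₁ ++ E₂) →
            Pointwise (ReplEq X t) E₁ E₁' → Pointwise (ReplEq X t) E₂ E₂' →
            Action done5 (E₁ ++ (var X , t) ∷ E₂) (E₁' ++ (var X , t) ∷ E₂')

module Submission where

open import Defs
open import Data.Bool using (Bool)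
open import Data.Nat using (_<?_)
open import Data.Nat.Properties using (_≟_)
open import Data.Fin using (Fin; toℕ; fromℕ<)
open import Data.Fin.Properties using (fromℕ<-toℕ; toℕ<n)
open import Data.List using ([]; _∷_; [_]; _++_; map; tabulate)
open import Data.List.Membership.Propositional.Properties using (∈-insert)
open import Data.List.Relation.Unary.All using ([]; _∷_; head; tail; lookup)
open import Data.List.Relation.Unary.All.Properties using (++⁺; ++⁻; tabulate⁺; tabulate⁻)
open import Data.List.Relation.Binary.Pointwise as Pointwise using (Pointwise; []; _∷_)
open import Data.Product using (_,_)
open import Function.Bundles using (_⇔_; mk⇔; Equivalence)
open import Relation.Nullary using (yes; no; contradiction)
open import Relation.Binary.PropositionalEquality using (_≡_; refl; sym; trans; cong)

-- Actions (1), (3) and (4) rewrite a single equation into a set with the same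
-- i-solutions; for (1) this is because an i-term is determined by its root
-- symbol together with its immediate subtrees.  Actions (5) and (5') only
-- replace occurrences of X by t, which no i-substitution solving X = t can
-- see, and both the old and the new set contain X = t.

module _ {S : Signature} where
  open Signature S

  ⟪⟫-fun-arg : (θ : ISubst {S}) (f : F) (ts : Fin (ar f) → Term S) (i : Fin (ar f)) (p : Pos {S}) →
               (fun f ts ⟪ θ ⟫) (toℕ i ∷ p) ≡ (ts i ⟪ θ ⟫) p
  ⟪⟫-fun-arg θ f ts i p with toℕ i <? ar f
  ... | yes i<ar = cong (λ j → (ts j ⟪ θ ⟫) p) (fromℕ<-toℕ i i<ar)
  ... | no  i≮ar = contradiction (toℕ<n i) i≮ar

  ISolEq-fun-cong : (θ : ISubst {S}) (f : F) (ss ts : Fin (ar f) → Term S) →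
                    (∀ i → ISolEq θ (ss i , ts i)) → ISolEq θ (fun f ss , fun f ts)
  ISolEq-fun-cong θ f ss ts ss≈ts []      = refl
  ISolEq-fun-cong θ f ss ts ss≈ts (i ∷ p) with i <? ar f
  ... | yes i<ar = ss≈ts (fromℕ< i<ar) p
  ... | no  _    = refl

  ISolEq-fun⇔ : (θ : ISubst {S}) (f : F) (ss ts : Fin (ar f) → Term S) →
                ISolEq θ (fun f ss , fun f ts) ⇔ ISol θ (tabulate (λ i → ss i , ts i))
  ISolEq-fun⇔ θ f ss ts = mk⇔
    (λ sol → tabulate⁺ λ i p →
      trans (sym (⟪⟫-fun-arg θ f ss i p)) (trans (sol (toℕ i ∷ p)) (⟪⟫-fun-arg θ f ts i p)))
    (λ sols → ISolEq-fun-cong θ f ss ts (tabulate⁻ sols))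

  ISolEq-swap⇔ : (θ : ISubst {S}) (s t : Term S) → ISolEq θ (s , t) ⇔ ISol θ [ t , s ]
  ISolEq-swap⇔ θ s t = mk⇔ (λ s≈t → (λ p → sym (s≈t p)) ∷ []) (λ { (t≈s ∷ []) p → sym (t≈s p) })

  ISol-replace : {θ : ISubst {S}} (E₁ E₂ : Eqns {S}) {e : Eqn {S}} {E : Eqns {S}} →
                 ISolEq θ e ⇔ ISol θ E → ISol θ (E₁ ++ e ∷ E₂) ⇔ ISol θ (E₁ ++ E ++ E₂)
  ISol-replace E₁ E₂ {e} e⇔E = mk⇔
    (λ sol → let sol₁ , sol-eE₂ = ++⁻ E₁ {e ∷ E₂} sol in
               ++⁺ sol₁ (++⁺ (to (head sol-eE₂)) (tail sol-eE₂)))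
    (λ sol → let sol₁ , sol′ = ++⁻ E₁ sol ; sol-E , sol₂ = ++⁻ _ sol′ in
               ++⁺ sol₁ (from sol-E ∷ sol₂))
    where open Equivalence e⇔E

  Repl-refl : {X : Var} {t : Term S} (u : Term S) → Repl X t u u
  Repl-refl (var y)    = keepV
  Repl-refl (fun f us) = under (λ i → Repl-refl (us i))

  Repl-[↦] : (X : Var) (t u : Term S) → Repl X t u ([ X ↦ t ] u)
  Repl-[↦] X t (var y) with y ≟ X
  ... | yes refl = replX
  ... | no  _    = keepV
  Repl-[↦] X t (fun f us) = under (λ i → Repl-[↦] X t (us i))

  ReplEqs-[↦]ₑ : (X : Var) (t : Term S) (E : Eqns {S}) → Pointwise (ReplEq X t) E (map [ X ↦ t ]ₑ E)
  ReplEqs-[↦]ₑ X t []            = []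
  ReplEqs-[↦]ₑ X t ((u , v) ∷ E) = (Repl-[↦] X t u , Repl-[↦] X t v) ∷ ReplEqs-[↦]ₑ X t E

  Repl-sound : {θ : ISubst {S}} {X : Var} {t : Term S} → ISolEq θ (var X , t) →
               {u u′ : Term S} → Repl X t u u′ → ISolEq θ (u , u′)
  Repl-sound X≈t keepX             p       = refl
  Repl-sound X≈t replX             p       = X≈t p
  Repl-sound X≈t keepV             p       = refl
  Repl-sound X≈t (under {f} us≈us′) []      = refl
  Repl-sound X≈t (under {f} us≈us′) (i ∷ p) with i <? ar f
  ... | yes i<ar = Repl-sound X≈t (us≈us′ (fromℕ< i<ar)) p
  ... | no  _    = refl

  ISolEq-ReplEq⇔ : {θ : ISubst {S}} {X : Var} {t : Term S} → ISolEq θ (var X , t) →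
                   {e e′ : Eqn {S}} → ReplEq X t e e′ → ISolEq θ e ⇔ ISolEq θ e′
  ISolEq-ReplEq⇔ X≈t (ru , rv) = mk⇔
    (λ sol p → trans (sym (Repl-sound X≈t ru p)) (trans (sol p) (Repl-sound X≈t rv p)))
    (λ sol p → trans (Repl-sound X≈t ru p) (trans (sol p) (sym (Repl-sound X≈t rv p))))

  ISol-ReplEqs⇔ : {θ : ISubst {S}} {X : Var} {t : Term S} → ISolEq θ (var X , t) →
                  {E E′ : Eqns {S}} → Pointwise (ReplEq X t) E E′ → ISol θ E ⇔ ISol θ E′
  ISol-ReplEqs⇔ X≈t []       = mk⇔ (λ _ → []) (λ _ → [])
  ISol-ReplEqs⇔ X≈t (r ∷ rs) = mk⇔
    (λ { (sol ∷ sols) → to   (ISolEq-ReplEq⇔ X≈t r) sol ∷ to   (ISol-ReplEqs⇔ X≈t rs) sols })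
    (λ { (sol ∷ sols) → from (ISolEq-ReplEq⇔ X≈t r) sol ∷ from (ISol-ReplEqs⇔ X≈t rs) sols })
    where open Equivalence

  IEquiv-ReplEqs-around : {X : Var} {t : Term S} (E₁ E₁′ : Eqns {S}) {E₂ E₂′ : Eqns {S}} →
                          Pointwise (ReplEq X t) E₁ E₁′ → Pointwise (ReplEq X t) E₂ E₂′ →
                          IEquiv (E₁ ++ (var X , t) ∷ E₂) (E₁′ ++ (var X , t) ∷ E₂′)
  IEquiv-ReplEqs-around {X} {t} E₁ E₁′ rs₁ rs₂ θ = mk⇔
    (λ sol → Equivalence.to   (ISol-ReplEqs⇔ (lookup sol (∈-insert E₁))  rs) sol)
    (λ sol → Equivalence.from (ISol-ReplEqs⇔ (lookup sol (∈-insert E₁′)) rs) sol)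
    where
    rs : Pointwise (ReplEq X t) (E₁ ++ (var X , t) ∷ _) (E₁′ ++ (var X , t) ∷ _)
    rs = Pointwise.++⁺ rs₁ ((keepX , Repl-refl t) ∷ rs₂)

lemma8 : (S : Signature) (done5 : Bool) (E E' : Eqns {S}) →
    Action done5 E E' → IEquiv E E'
lemma8 S _ _ _ (act1 E₁ E₂ f ss ts) θ = ISol-replace E₁ E₂ (ISolEq-fun⇔ θ f ss ts)
lemma8 S _ _ _ (act3 E₁ E₂ X)       θ = ISol-replace E₁ E₂ (mk⇔ (λ _ → []) (λ _ _ → refl))
lemma8 S _ _ _ (act4 E₁ E₂ X f ts)  θ = ISol-replace E₁ E₂ (ISolEq-swap⇔ θ (fun f ts) (var X))
lemma8 S _ _ _ (act5 E₁ E₂ X t _ _) =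
  IEquiv-ReplEqs-around E₁ (map [ X ↦ t ]ₑ E₁) (ReplEqs-[↦]ₑ X t E₁) (ReplEqs-[↦]ₑ X t E₂)
lemma8 S _ _ _ (act5' E₁ E₂ E₁′ E₂′ X t _ _ _ rs₁ rs₂) = IEquiv-ReplEqs-around E₁ E₁′ rs₁ rs₂
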